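{- Let $q\geq 2$ be a prime power, $k\geq 3$, $r\geq 4$ with $(r,q)\neq(4,2)$, and $n=2k+r$. Let $f(n,k,q)={n-1\brack k-1}-q^{k(k-1)}{n-k-1\brack k-1}+q^k$. Then $$f(n,k,q)>{k\brack 1}{n-2\brack k-2}-q{k\brack 2}{n-3\brack k-3}>\Big(1-\frac{1}{q^r(q^2-1)}\Big){k\brack 1}{n-2\brack k-2}.$$
   Context: Gaussian binomial coefficient: ${m\brack j}=\prod_{0\leq i<j}\frac{q^{m-i}-1}{q^{j-i}-1}$, equal to $1$ when $j=0$. -}

module Defs where

open import Data.Nat using (ℕ; zero; suc; _+_; _*_; _∸_; _^_; _/_; _≤_)
open import Data.Nat.Primality using (Prime)
open import Data.Product using (Σ; _×_)
open import Relation.Binary.PropositionalEquality using (_≡_)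

IsPrimePower : ℕ → Set
IsPrimePower q = Σ ℕ λ p → Σ ℕ λ e → Prime p × (1 ≤ e) × (q ≡ p ^ e)

prodBelow : ℕ → (ℕ → ℕ) → ℕ
prodBelow zero    f = 1
prodBelow (suc j) f = prodBelow j f * f j

-- natural-number division, with the (never used for q ≥ 2) convention a / 0 = 0
divℕ : ℕ → ℕ → ℕ
divℕ a zero    = 0
divℕ a (suc b) = a / suc b

-- Gaussian binomial coefficient [m over j]_q
--   = ∏_{0≤i<j} (q^(m-i) - 1) / (q^(j-i) - 1),  = 1 when j = 0.
-- Computed as (∏ numerators) / (∏ denominators); the quotient is exact for q ≥ 2.
gauss : ℕ → ℕ → ℕ → ℕ
gauss q m j = divℕ (prodBelow j (λ i → q ^ (m ∸ i) ∸ 1))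
                   (prodBelow j (λ i → q ^ (j ∸ i) ∸ 1))

module Submission where

-- Gaussian coefficients are handled through the q-Pascal recursion G (for which no division is
-- needed) and identified with the quotient formula of Defs by the product formula.  From the
-- recursion we get the q-Vandermonde expansion [a+b over m] = ∑_j T j; absorption
-- [i+1][a+1 over i+1] = [a+1][a over i] and its iterate [s+c over s][c over i] =
-- [s+c over s+i][s+i over s] turn [k][n-2 over k-2] and [k over 2][n-3 over k-3] into the SAME
-- Vandermonde sum ∑_j T j, weighted by [j] and [j over 2] (weighted-vandermonde).  Since
-- [j] ≤ 1 + q [j over 2], the middle term is at most ∑_{j≥1} T j, which is f - q^k: the first
-- inequality.  The second is, after absorption, q^(r+1) (q-1) [k-1] [k-2] < [n-2], an elementary
-- estimate on powers of q.

open import Defs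
open import Data.Nat using (ℕ)

module Sums where

  open import Data.Nat
  open import Data.Nat.Properties
  open import Relation.Binary.PropositionalEquality
  open import Data.Nat.Tactic.RingSolver using (solve-∀)

  ∑ : ℕ → (ℕ → ℕ) → ℕ
  ∑ zero    f = 0
  ∑ (suc n) f = f 0 + ∑ n (λ i → f (suc i))

  ∑-cong : ∀ n {f g : ℕ → ℕ} → (∀ i → i < n → f i ≡ g i) → ∑ n f ≡ ∑ n g
  ∑-cong zero    eq = refl
  ∑-cong (suc n) eq = cong₂ _+_ (eq 0 z<s) (∑-cong n (λ i i<n → eq (suc i) (s<s i<n)))

  ∑-zero : ∀ n (f : ℕ → ℕ) → (∀ i → i < n → f i ≡ 0) → ∑ n f ≡ 0
  ∑-zero zero    f vanish = refl
  ∑-zero (suc n) f vanish =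
    cong₂ _+_ (vanish 0 z<s) (∑-zero n (λ i → f (suc i)) (λ i i<n → vanish (suc i) (s<s i<n)))

  ∑-+ : ∀ n (f g : ℕ → ℕ) → ∑ n (λ i → f i + g i) ≡ ∑ n f + ∑ n g
  ∑-+ zero    f g = refl
  ∑-+ (suc n) f g = begin
      f 0 + g 0 + ∑ n (λ i → f (suc i) + g (suc i))
    ≡⟨ cong (f 0 + g 0 +_) (∑-+ n (λ i → f (suc i)) (λ i → g (suc i))) ⟩
      f 0 + g 0 + (∑ n (λ i → f (suc i)) + ∑ n (λ i → g (suc i)))
    ≡⟨ +-interchange (f 0) (g 0) _ _ ⟩
      f 0 + ∑ n (λ i → f (suc i)) + (g 0 + ∑ n (λ i → g (suc i))) ∎
    where
      open ≡-Reasoning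
      +-interchange : ∀ a b c d → a + b + (c + d) ≡ a + c + (b + d)
      +-interchange = solve-∀

  ∑-*ˡ : ∀ n c (f : ℕ → ℕ) → c * ∑ n f ≡ ∑ n (λ i → c * f i)
  ∑-*ˡ zero    c f = *-zeroʳ c
  ∑-*ˡ (suc n) c f =
    trans (*-distribˡ-+ c (f 0) _) (cong (c * f 0 +_) (∑-*ˡ n c (λ i → f (suc i))))

  ∑-mono : ∀ n {f g : ℕ → ℕ} → (∀ i → f i ≤ g i) → ∑ n f ≤ ∑ n g
  ∑-mono zero    le = z≤n
  ∑-mono (suc n) le = +-mono-≤ (le 0) (∑-mono n (λ i → le (suc i)))

  ∑-split : ∀ s n (f : ℕ → ℕ) → ∑ (s + n) f ≡ ∑ s f + ∑ n (λ i → f (s + i))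
  ∑-split zero    n f = refl
  ∑-split (suc s) n f =
    trans (cong (f 0 +_) (∑-split s n (λ i → f (suc i)))) (sym (+-assoc (f 0) _ _))

module QBinomial (q : ℕ) where

  open import Data.Nat
  open import Data.Nat.Properties
  open import Data.Product using (_,_)
  open import Relation.Nullary using (yes; no)
  open import Relation.Binary.PropositionalEquality hiding ([_])
  open import Data.Nat.Tactic.RingSolver using (solve-∀)
  open Sums

  G : ℕ → ℕ → ℕ
  G m       zero    = 1
  G zero    (suc j) = 0
  G (suc m) (suc j) = G m j + q ^ suc j * G m (suc j)

  [_] : ℕ → ℕ
  [ m ] = G m 1

  G-vanish : ∀ m j → m < j → G m j ≡ 0
  G-vanish zero    (suc j) _ = refl
  G-vanish (suc m) (suc j) (s<s m<j)
    rewrite G-vanish m j m<j | G-vanish m (suc j) (m<n⇒m<1+n m<j) = *-zeroʳ (q ^ suc j)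

  G-pos : ∀ m j → j ≤ m → 1 ≤ G m j
  G-pos m       zero    _         = ≤-refl
  G-pos (suc m) (suc j) (s≤s j≤m) = ≤-trans (G-pos m j j≤m) (m≤m+n (G m j) _)

  -- [j] = 1 + q [j-1] ≤ 1 + q [j over 2]: the termwise estimate behind the first inequality.
  q-integer≤ : ∀ j → [ j ] ≤ 1 + q * G j 2
  q-integer≤ zero    = z≤n
  q-integer≤ (suc j) = s≤s (≤-trans (≤-reflexive (cong (_* [ j ]) (*-identityʳ q)))
                                   (*-monoʳ-≤ q (m≤m+n [ j ] (q ^ 2 * G j 2))))

  vterm : ℕ → ℕ → ℕ → ℕ → ℕ
  vterm a b m j = q ^ ((a ∸ j) * (m ∸ j)) * G a j * G b (m ∸ j)

  exponent-shift : ∀ a m i → i < a → i ≤ m →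
                   (a ∸ i) * (m ∸ i) + suc i ≡ suc m + (a ∸ suc i) * (m ∸ i)
  exponent-shift a m i i<a i≤m with m≤n⇒∃[o]m+o≡n i<a | m≤n⇒∃[o]m+o≡n i≤m
  ... | c , refl | d , refl
    rewrite sym (+-suc i c) | m+n∸m≡n i (suc c) | m+n∸m≡n i c | m+n∸m≡n i d = shape i c d
    where
      shape : ∀ i c d → suc c * d + suc i ≡ suc (i + d) + c * d
      shape = solve-∀

  power-shift : ∀ a m i → i ≤ m →
                q ^ ((a ∸ i) * (m ∸ i)) * q ^ suc i * G a (suc i)
                ≡ q ^ suc m * q ^ ((a ∸ suc i) * (m ∸ i)) * G a (suc i)
  power-shift a m i i≤m with i <? a
  ... | yes i<a = cong (_* G a (suc i)) (begin
      q ^ ((a ∸ i) * (m ∸ i)) * q ^ suc i     ≡⟨ ^-distribˡ-+-* q ((a ∸ i) * (m ∸ i)) (suc i) ⟨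
      q ^ ((a ∸ i) * (m ∸ i) + suc i)         ≡⟨ cong (q ^_) (exponent-shift a m i i<a i≤m) ⟩
      q ^ (suc m + (a ∸ suc i) * (m ∸ i))     ≡⟨ ^-distribˡ-+-* q (suc m) _ ⟩
      q ^ suc m * q ^ ((a ∸ suc i) * (m ∸ i)) ∎)
    where open ≡-Reasoning
  ... | no i≮a rewrite G-vanish a (suc i) (s≤s (≮⇒≥ i≮a)) =
    trans (*-zeroʳ (q ^ ((a ∸ i) * (m ∸ i)) * q ^ suc i))
          (sym (*-zeroʳ (q ^ suc m * q ^ ((a ∸ suc i) * (m ∸ i)))))

  vterm-head : ∀ a b m → vterm (suc a) b (suc m) 0 ≡ q ^ suc m * vterm a b (suc m) 0
  vterm-head a b m = begin
      q ^ (suc m + a * suc m) * 1 * G b (suc m)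
    ≡⟨ cong (λ x → x * 1 * G b (suc m)) (^-distribˡ-+-* q (suc m) (a * suc m)) ⟩
      q ^ suc m * q ^ (a * suc m) * 1 * G b (suc m)
    ≡⟨ reassoc (q ^ suc m) (q ^ (a * suc m)) (G b (suc m)) ⟩
      q ^ suc m * (q ^ (a * suc m) * 1 * G b (suc m)) ∎
    where
      open ≡-Reasoning
      reassoc : ∀ x y z → x * y * 1 * z ≡ x * (y * 1 * z)
      reassoc = solve-∀

  vterm-pascal : ∀ a b m i → i ≤ m →
                 vterm (suc a) b (suc m) (suc i) ≡ vterm a b m i + q ^ suc m * vterm a b (suc m) (suc i)
  vterm-pascal a b m i i≤m = begin
      x * (G a i + q ^ suc i * G a (suc i)) * y
    ≡⟨ distrib x (G a i) (q ^ suc i) (G a (suc i)) y ⟩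
      x * G a i * y + x * q ^ suc i * G a (suc i) * y
    ≡⟨ cong (λ z → x * G a i * y + z * y) (power-shift a m i i≤m) ⟩
      x * G a i * y + q ^ suc m * x′ * G a (suc i) * y
    ≡⟨ cong (x * G a i * y +_) (reassoc (q ^ suc m) x′ (G a (suc i)) y) ⟩
      x * G a i * y + q ^ suc m * (x′ * G a (suc i) * y) ∎
    where
      open ≡-Reasoning
      x  = q ^ ((a ∸ i) * (m ∸ i))
      x′ = q ^ ((a ∸ suc i) * (m ∸ i))
      y  = G b (m ∸ i)
      distrib : ∀ x g p h y → x * (g + p * h) * y ≡ x * g * y + x * p * h * y
      distrib = solve-∀
      reassoc : ∀ Q x h y → Q * x * h * y ≡ Q * (x * h * y)
      reassoc = solve-∀

  vandermonde : ∀ a b m → G (a + b) m ≡ ∑ (suc m) (vterm a b m)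
  vandermonde zero b m = sym (begin
      1 * 1 * G b m + ∑ m (λ i → vterm 0 b m (suc i))
    ≡⟨ cong₂ _+_ (*-identityˡ (G b m)) (∑-zero m _ (λ i _ → tail-vanishes i)) ⟩
      G b m + 0
    ≡⟨ +-identityʳ (G b m) ⟩
      G b m ∎)
    where
      open ≡-Reasoning
      tail-vanishes : ∀ i → vterm 0 b m (suc i) ≡ 0
      tail-vanishes i = trans (cong (_* G b (m ∸ suc i)) (*-zeroʳ (q ^ 0))) (*-zeroˡ (G b (m ∸ suc i)))
  vandermonde (suc a) b zero = cong (λ e → q ^ e * 1 * 1 + 0) (sym (*-zeroʳ a))
  vandermonde (suc a) b (suc m) = sym (begin
      vterm (suc a) b (suc m) 0 + ∑ (suc m) (λ i → vterm (suc a) b (suc m) (suc i))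
    ≡⟨ cong₂ _+_ (vterm-head a b m) (∑-cong (suc m) (λ i i≤m → vterm-pascal a b m i (s≤s⁻¹ i≤m))) ⟩
      Q * V′ 0 + ∑ (suc m) (λ i → vterm a b m i + Q * V′ (suc i))
    ≡⟨ cong (Q * V′ 0 +_) (∑-+ (suc m) (vterm a b m) (λ i → Q * V′ (suc i))) ⟩
      Q * V′ 0 + (∑ (suc m) (vterm a b m) + ∑ (suc m) (λ i → Q * V′ (suc i)))
    ≡⟨ cong (λ s → Q * V′ 0 + (∑ (suc m) (vterm a b m) + s)) (∑-*ˡ (suc m) Q (λ i → V′ (suc i))) ⟨
      Q * V′ 0 + (∑ (suc m) (vterm a b m) + Q * ∑ (suc m) (λ i → V′ (suc i)))
    ≡⟨ regroup Q (V′ 0) (∑ (suc m) (vterm a b m)) (∑ (suc m) (λ i → V′ (suc i))) ⟩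
      ∑ (suc m) (vterm a b m) + Q * ∑ (suc (suc m)) V′
    ≡⟨ cong₂ (λ s t → s + Q * t) (vandermonde a b m) (vandermonde a b (suc m)) ⟨
      G (a + b) m + Q * G (a + b) (suc m) ∎)
    where
      open ≡-Reasoning
      Q  = q ^ suc m
      V′ = vterm a b (suc m)
      regroup : ∀ Q h s t → Q * h + (s + Q * t) ≡ s + Q * (h + t)
      regroup = solve-∀

  weighted-sum-bound : ∀ m (T : ℕ → ℕ) →
    ∑ (suc m) (λ j → T j * [ j ]) ≤ ∑ m (λ i → T (suc i)) + q * ∑ (suc m) (λ j → T j * G j 2)
  weighted-sum-bound m T = begin
      T 0 * 0 + ∑ m (λ i → T (suc i) * [ suc i ])
    ≡⟨ cong (_+ ∑ m (λ i → T (suc i) * [ suc i ])) (*-zeroʳ (T 0)) ⟩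
      ∑ m (λ i → T (suc i) * [ suc i ])
    ≤⟨ ∑-mono m (λ i → *-monoʳ-≤ (T (suc i)) (q-integer≤ (suc i))) ⟩
      ∑ m (λ i → T (suc i) * (1 + q * G (suc i) 2))
    ≡⟨ ∑-cong m (λ i _ → expand q (T (suc i)) (G (suc i) 2)) ⟩
      ∑ m (λ i → T (suc i) + q * (T (suc i) * G (suc i) 2))
    ≡⟨ ∑-+ m (λ i → T (suc i)) (λ i → q * (T (suc i) * G (suc i) 2)) ⟩
      ∑ m (λ i → T (suc i)) + ∑ m (λ i → q * (T (suc i) * G (suc i) 2))
    ≡⟨ cong (∑ m (λ i → T (suc i)) +_) (∑-*ˡ m q (λ i → T (suc i) * G (suc i) 2)) ⟨
      ∑ m (λ i → T (suc i)) + q * ∑ m (λ i → T (suc i) * G (suc i) 2)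
    ≤⟨ +-monoʳ-≤ (∑ m (λ i → T (suc i))) (*-monoʳ-≤ q (m≤n+m _ (T 0 * G 0 2))) ⟩
      ∑ m (λ i → T (suc i)) + q * ∑ (suc m) (λ j → T j * G j 2) ∎
    where
      open ≤-Reasoning
      expand : ∀ q t g → t * (1 + q * g) ≡ t + q * (t * g)
      expand = solve-∀

module Products where

  open import Data.Nat
  open import Data.Nat.Properties
  open import Relation.Binary.PropositionalEquality

  prod-front : ∀ j f → prodBelow (suc j) f ≡ f 0 * prodBelow j (λ i → f (suc i))
  prod-front zero    f = trans (*-identityˡ (f 0)) (sym (*-identityʳ (f 0)))
  prod-front (suc j) f =
    trans (cong (_* f (suc j)) (prod-front j f)) (*-assoc (f 0) _ (f (suc j)))

  prod-reverse : ∀ j (g : ℕ → ℕ) → prodBelow j (λ i → g (j ∸ i)) ≡ prodBelow j (λ i → g (suc i))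
  prod-reverse zero    g = refl
  prod-reverse (suc j) g =
    trans (prod-front j (λ i → g (suc j ∸ i)))
          (trans (cong (g (suc j) *_) (prod-reverse j g)) (*-comm (g (suc j)) _))

-- Gaussian coefficients for a base q = 2 + w ≥ 2, where the quotient formula of Defs agrees
-- with the q-Pascal coefficients and identities proved by cancellation are available.
module QBinomialLarge (w : ℕ) where

  open import Data.Nat
  open import Data.Nat.Properties
  open import Data.Nat.DivMod using (m*n/n≡m)
  open import Relation.Nullary using (yes; no; contradiction)
  open import Relation.Binary.PropositionalEquality hiding ([_])
  open import Data.Nat.Tactic.RingSolver using (solve-∀)
  open Sums
  open Products

  q : ℕ
  q = 2 + w

  open QBinomial q public

  q^n≥1 : ∀ n → 1 ≤ q ^ n
  q^n≥1 n = m^n>0 q n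

  numerator : ℕ → ℕ → ℕ
  numerator m j = prodBelow j (λ i → q ^ (m ∸ i) ∸ 1)

  denominator : ℕ → ℕ
  denominator j = prodBelow j (λ i → q ^ suc i ∸ 1)

  -- Each factor q^(i+1) - 1 is at least 1, so the quotient in gauss is exact.
  denominator-pos : ∀ j → 1 ≤ denominator j
  denominator-pos zero    = ≤-refl
  denominator-pos (suc j) = *-mono-≤ (denominator-pos j) (m<n⇒0<n∸m q^[1+j]≥2)
    where
      q^[1+j]≥2 : 2 ≤ q ^ suc j
      q^[1+j]≥2 = *-mono-≤ {2} {q} (s≤s (s≤s z≤n)) (q^n≥1 j)

  -- The factor q^(m-m) - 1 = 0 kills the numerator once j > m.
  numerator-vanishes : ∀ m j → m ≤ j → numerator m (suc j) ≡ 0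
  numerator-vanishes m j m≤j
    rewrite m≤n⇒m∸n≡0 m≤j = *-zeroʳ (numerator m j)

  telescope : ∀ j m → j ≤ m → q ^ suc j ∸ 1 + q ^ suc j * (q ^ (m ∸ j) ∸ 1) ≡ q ^ suc m ∸ 1
  telescope j m j≤m = begin
      q ^ suc j ∸ 1 + q ^ suc j * (q ^ (m ∸ j) ∸ 1)
    ≡⟨ split (q ^ suc j) (q ^ (m ∸ j)) (q^n≥1 (suc j)) (q^n≥1 (m ∸ j)) ⟩
      q ^ suc j * q ^ (m ∸ j) ∸ 1
    ≡⟨ cong (_∸ 1) (^-distribˡ-+-* q (suc j) (m ∸ j)) ⟨
      q ^ suc (j + (m ∸ j)) ∸ 1
    ≡⟨ cong (λ e → q ^ suc e ∸ 1) (m+[n∸m]≡n j≤m) ⟩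
      q ^ suc m ∸ 1 ∎
    where
      open ≡-Reasoning
      split : ∀ A B → 1 ≤ A → 1 ≤ B → A ∸ 1 + A * (B ∸ 1) ≡ A * B ∸ 1
      split (suc a) (suc b) _ _ = identity a b
        where
          identity : ∀ a b → a + suc a * b ≡ b + a * suc b
          identity = solve-∀

  -- The numerator analogue of the q-Pascal rule (trivial when the numerator vanishes).
  numerator-pascal : ∀ m j → (q ^ suc j ∸ 1 + q ^ suc j * (q ^ (m ∸ j) ∸ 1)) * numerator m j
                             ≡ (q ^ suc m ∸ 1) * numerator m j
  numerator-pascal m j with j ≤? m
  ... | yes j≤m = cong (_* numerator m j) (telescope j m j≤m)
  numerator-pascal m (suc j) | no j≰m rewrite numerator-vanishes m j (s≤s⁻¹ (≰⇒> j≰m)) =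
    trans (*-zeroʳ (q ^ suc (suc j) ∸ 1 + q ^ suc (suc j) * (q ^ (m ∸ suc j) ∸ 1)))
          (sym (*-zeroʳ (q ^ suc m ∸ 1)))
  numerator-pascal m zero    | no j≰m = contradiction z≤n j≰m

  product-formula : ∀ m j → denominator j * G m j ≡ numerator m j
  product-formula m       zero    = refl
  product-formula zero    (suc j) = trans (*-zeroʳ (denominator (suc j))) (sym (numerator-vanishes 0 j z≤n))
  product-formula (suc m) (suc j) = begin
      d * e * (G m j + Q * G m (suc j))
    ≡⟨ regroup d e (G m j) Q (G m (suc j)) ⟩
      e * (d * G m j) + Q * (d * e * G m (suc j))
    ≡⟨ cong₂ (λ x y → e * x + Q * y) (product-formula m j) (product-formula m (suc j)) ⟩
      e * N + Q * (N * f)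
    ≡⟨ factor e N Q f ⟩
      (e + Q * f) * N
    ≡⟨ numerator-pascal m j ⟩
      (q ^ suc m ∸ 1) * N
    ≡⟨ prod-front j (λ i → q ^ (suc m ∸ i) ∸ 1) ⟨
      numerator (suc m) (suc j) ∎
    where
      open ≡-Reasoning
      d = denominator j
      e = q ^ suc j ∸ 1
      Q = q ^ suc j
      f = q ^ (m ∸ j) ∸ 1
      N = numerator m j
      regroup : ∀ d e g Q h → d * e * (g + Q * h) ≡ e * (d * g) + Q * (d * e * h)
      regroup = solve-∀
      factor : ∀ e N Q f → e * N + Q * (N * f) ≡ (e + Q * f) * N
      factor = solve-∀

  gauss≡G : ∀ m j → gauss q m j ≡ G m j
  gauss≡G m j = begin
      divℕ (numerator m j) (prodBelow j (λ i → q ^ (j ∸ i) ∸ 1))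
    ≡⟨ cong₂ divℕ (sym (product-formula m j)) (prod-reverse j (λ x → q ^ x ∸ 1)) ⟩
      divℕ (denominator j * G m j) (denominator j)
    ≡⟨ divℕ-cancel (denominator j) (G m j) (denominator-pos j) ⟩
      G m j ∎
    where
      open ≡-Reasoning
      divℕ-cancel : ∀ d g → 1 ≤ d → divℕ (d * g) d ≡ g
      divℕ-cancel (suc d) g _ = trans (cong (_/ suc d) (*-comm (suc d) g)) (m*n/n≡m g (suc d))

  q-integer : ∀ n → (1 + w) * [ n ] + 1 ≡ q ^ n
  q-integer zero    = cong (_+ 1) (*-zeroʳ w)
  q-integer (suc n) = trans (step w [ n ]) (cong (q *_) (q-integer n))
    where
      step : ∀ w g → (1 + w) * (1 + (2 + w) * 1 * g) + 1 ≡ (2 + w) * ((1 + w) * g + 1)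
      step = solve-∀

  q-integer′ : ∀ n → (1 + w) * [ n ] ≡ q ^ n ∸ 1
  q-integer′ n = trans (sym (m+n∸n≡m ((1 + w) * [ n ]) 1)) (cong (_∸ 1) (q-integer n))

  -- Absorption:  [i+1] [a+1 over i+1] = [a+1] [a over i].
  -- Both sides times (q - 1) ∏_{l<i} (q^(l+1) - 1) equal the numerator ∏_{l≤i} (q^(a+1-l) - 1).
  absorption : ∀ a i → [ suc i ] * G (suc a) (suc i) ≡ [ suc a ] * G a i
  absorption a i = *-cancelˡ-≡ _ _ (c * d) {{>-nonZero (*-mono-≤ {1} {c} (s≤s z≤n) (denominator-pos i))}} (begin
      c * d * ([ suc i ] * G (suc a) (suc i))
    ≡⟨ regroup c d [ suc i ] (G (suc a) (suc i)) ⟩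
      d * (c * [ suc i ]) * G (suc a) (suc i)
    ≡⟨ cong (λ x → d * x * G (suc a) (suc i)) (q-integer′ (suc i)) ⟩
      denominator (suc i) * G (suc a) (suc i)
    ≡⟨ product-formula (suc a) (suc i) ⟩
      numerator (suc a) (suc i)
    ≡⟨ prod-front i (λ l → q ^ (suc a ∸ l) ∸ 1) ⟩
      (q ^ suc a ∸ 1) * numerator a i
    ≡⟨ cong₂ _*_ (q-integer′ (suc a)) (product-formula a i) ⟨
      c * [ suc a ] * (d * G a i)
    ≡⟨ regroup′ c d [ suc a ] (G a i) ⟩
      c * d * ([ suc a ] * G a i) ∎)
    where
      open ≡-Reasoning
      c = 1 + w
      d = denominator i
      regroup : ∀ c d s g → c * d * (s * g) ≡ d * (c * s) * g
      regroup = solve-∀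
      regroup′ : ∀ c d s g → c * s * (d * g) ≡ c * d * (s * g)
      regroup′ = solve-∀

  -- Subset-of-a-subset identity  [s+c over s] [c over i] = [s+c over s+i] [s+i over s],
  -- by induction on s, cancelling [s+1] and using absorption three times.
  revision : ∀ s c i → G (s + c) s * G c i ≡ G (s + c) (s + i) * G (s + i) s
  revision zero    c i = trans (*-identityˡ (G c i)) (sym (*-identityʳ (G c i)))
  revision (suc s) c i = *-cancelˡ-≡ _ _ [ suc s ] {{>-nonZero (G-pos (suc s) 1 (s≤s z≤n))}} (begin
      [ suc s ] * (G (suc s + c) (suc s) * G c i)
    ≡⟨ *-assoc [ suc s ] (G (suc s + c) (suc s)) (G c i) ⟨
      [ suc s ] * G (suc s + c) (suc s) * G c i
    ≡⟨ cong (_* G c i) (absorption (s + c) s) ⟩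
      [ suc s + c ] * G (s + c) s * G c i
    ≡⟨ *-assoc [ suc s + c ] (G (s + c) s) (G c i) ⟩
      [ suc s + c ] * (G (s + c) s * G c i)
    ≡⟨ cong ([ suc s + c ] *_) (revision s c i) ⟩
      [ suc s + c ] * (G (s + c) (s + i) * G (s + i) s)
    ≡⟨ *-assoc [ suc s + c ] (G (s + c) (s + i)) (G (s + i) s) ⟨
      [ suc s + c ] * G (s + c) (s + i) * G (s + i) s
    ≡⟨ cong (_* G (s + i) s) (absorption (s + c) (s + i)) ⟨
      [ suc s + i ] * G (suc s + c) (suc s + i) * G (s + i) s
    ≡⟨ regroup [ suc s + i ] (G (suc s + c) (suc s + i)) (G (s + i) s) ⟩
      G (suc s + c) (suc s + i) * ([ suc s + i ] * G (s + i) s)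
    ≡⟨ cong (G (suc s + c) (suc s + i) *_) (absorption (s + i) s) ⟨
      G (suc s + c) (suc s + i) * ([ suc s ] * G (suc s + i) (suc s))
    ≡⟨ regroup′ (G (suc s + c) (suc s + i)) [ suc s ] (G (suc s + i) (suc s)) ⟩
      [ suc s ] * (G (suc s + c) (suc s + i) * G (suc s + i) (suc s)) ∎)
    where
      open ≡-Reasoning
      regroup : ∀ x y z → x * y * z ≡ y * (x * z)
      regroup = solve-∀
      regroup′ : ∀ x y z → x * (y * z) ≡ y * (x * z)
      regroup′ = solve-∀

  weighted-vandermonde : ∀ s c b t →
    G (s + c) s * G (c + b) t ≡ ∑ (suc (s + t)) (λ j → vterm (s + c) b (s + t) j * G j s)
  weighted-vandermonde s c b t = begin
      G (s + c) s * G (c + b) t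
    ≡⟨ cong (G (s + c) s *_) (vandermonde c b t) ⟩
      G (s + c) s * ∑ (suc t) (vterm c b t)
    ≡⟨ ∑-*ˡ (suc t) (G (s + c) s) (vterm c b t) ⟩
      ∑ (suc t) (λ i → G (s + c) s * vterm c b t i)
    ≡⟨ ∑-cong (suc t) (λ i _ → shifted-term i) ⟩
      ∑ (suc t) (λ i → W (s + i))
    ≡⟨ cong (_+ ∑ (suc t) (λ i → W (s + i))) (∑-zero s W below-s) ⟨
      ∑ s W + ∑ (suc t) (λ i → W (s + i))
    ≡⟨ ∑-split s (suc t) W ⟨
      ∑ (s + suc t) W
    ≡⟨ cong (λ n → ∑ n W) (+-suc s t) ⟩
      ∑ (suc (s + t)) W ∎
    where
      open ≡-Reasoning
      W : ℕ → ℕ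
      W j = vterm (s + c) b (s + t) j * G j s

      below-s : ∀ j → j < s → W j ≡ 0
      below-s j j<s = trans (cong (vterm (s + c) b (s + t) j *_) (G-vanish j s j<s))
                            (*-zeroʳ (vterm (s + c) b (s + t) j))

      shifted-term : ∀ i → G (s + c) s * vterm c b t i ≡ W (s + i)
      shifted-term i rewrite [m+n]∸[m+o]≡n∸o s c i | [m+n]∸[m+o]≡n∸o s t i = begin
          G (s + c) s * (x * G c i * y)
        ≡⟨ regroup x (G (s + c) s) (G c i) y ⟩
          x * (G (s + c) s * G c i) * y
        ≡⟨ cong (λ z → x * z * y) (revision s c i) ⟩
          x * (G (s + c) (s + i) * G (s + i) s) * y
        ≡⟨ regroup′ x (G (s + c) (s + i)) (G (s + i) s) y ⟩
          x * G (s + c) (s + i) * y * G (s + i) s ∎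
        where
          x = q ^ ((c ∸ i) * (t ∸ i))
          y = G b (t ∸ i)
          regroup : ∀ x g h y → g * (x * h * y) ≡ x * (g * h) * y
          regroup = solve-∀
          regroup′ : ∀ x g h y → x * (g * h) * y ≡ x * g * y * h
          regroup′ = solve-∀

  -- q^x (q-1) [y] [z] < [x+y+z] for y ≥ 1: after multiplying by q - 1 this says
  -- Y A B < Y (A+1) (B+1) - 1 for Y = q^x ≥ 1, A = q^y - 1 ≥ 1 and B = q^z - 1.
  q-integer-product< : ∀ x y z → 1 ≤ y → q ^ x * (1 + w) * [ y ] * [ z ] < [ x + y + z ]
  q-integer-product< x y z y≥1 = *-cancelˡ-< (1 + w) _ _ (begin-strict
      (1 + w) * (Y * (1 + w) * [ y ] * [ z ])
    ≡⟨ regroup (1 + w) Y [ y ] [ z ] ⟩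
      Y * A * B
    <⟨ s≤s⁻¹ (begin
        2 + Y * A * B
      ≤⟨ +-monoˡ-≤ (Y * A * B) R≥2 ⟩
        R + Y * A * B
      ≡⟨ expand Y A B ⟨
        Y * (A + 1) * (B + 1)
      ≡⟨ powers ⟨
        W + 1
      ≡⟨ +-comm W 1 ⟩
        1 + W ∎) ⟩
      W ∎)
    where
      open ≤-Reasoning
      Y = q ^ x
      A = (1 + w) * [ y ]
      B = (1 + w) * [ z ]
      W = (1 + w) * [ x + y + z ]
      R = Y * A + Y * B + Y
      R≥2 : 2 ≤ R
      R≥2 = +-mono-≤ (≤-trans (*-mono-≤ (q^n≥1 x) (*-mono-≤ {1} {1 + w} (s≤s z≤n) (G-pos y 1 y≥1)))
                              (m≤m+n (Y * A) (Y * B)))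
                     (q^n≥1 x)
      powers : W + 1 ≡ Y * (A + 1) * (B + 1)
      powers = begin-equality
          W + 1                   ≡⟨ q-integer (x + y + z) ⟩
          q ^ (x + y + z)         ≡⟨ ^-distribˡ-+-* q (x + y) z ⟩
          q ^ (x + y) * q ^ z     ≡⟨ cong (_* q ^ z) (^-distribˡ-+-* q x y) ⟩
          Y * q ^ y * q ^ z       ≡⟨ cong₂ (λ a b → Y * a * b) (q-integer y) (q-integer z) ⟨
          Y * (A + 1) * (B + 1)   ∎
      regroup : ∀ c Y s t → c * (Y * c * s * t) ≡ Y * (c * s) * (c * t)
      regroup = solve-∀
      expand : ∀ Y A B → Y * (A + 1) * (B + 1) ≡ Y * A + Y * B + Y + Y * A * B
      expand = solve-∀

-- The two natural-number inequalities behind the theorem, for q = 2 + w, k = 3 + K and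
-- n = 2k + r, so that n - k - 1 = b below, n - 1 = k + b, n - 2 = (2+K) + b, n - 3 = (1+K) + b.
module Bounds (w K r : ℕ) where

  open import Data.Nat
  open import Data.Nat.Properties
  open import Relation.Binary.PropositionalEquality hiding ([_])
  open import Data.Nat.Tactic.RingSolver using (solve-∀)
  open Sums
  open QBinomialLarge w

  k b : ℕ
  k = 3 + K
  b = 2 + (K + r)

  -- Vandermonde terms of [n-1 over k-1] = [k+b over 2+K], and the sum S of those with j ≥ 1.
  T : ℕ → ℕ
  T = vterm k b (2 + K)

  S : ℕ
  S = ∑ (2 + K) (λ i → T (suc i))

  X : ℕ
  X = G ((1 + K) + b) K

  leading-term : G (k + b) (2 + K) ≡ q ^ (k * (2 + K)) * G b (2 + K) + S
  leading-term = trans (vandermonde k b (2 + K))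
                       (cong (λ x → x * G b (2 + K) + S) (*-identityʳ (q ^ (k * (2 + K)))))

  -- [k] [n-2 over k-2] ≤ S + q [k over 2] [n-3 over k-3]: both products are weighted
  -- versions of the same Vandermonde sum, with weights [j] and [j over 2].
  first-bound : [ k ] * G ((2 + K) + b) (1 + K) ≤ S + q * G k 2 * X
  first-bound = begin
      [ k ] * G ((2 + K) + b) (1 + K)
    ≡⟨ weighted-vandermonde 1 (2 + K) b (1 + K) ⟩
      ∑ (3 + K) (λ j → T j * [ j ])
    ≤⟨ weighted-sum-bound (2 + K) T ⟩
      S + q * ∑ (3 + K) (λ j → T j * G j 2)
    ≡⟨ cong (λ x → S + q * x) (weighted-vandermonde 2 (1 + K) b K) ⟨
      S + q * (G k 2 * X)
    ≡⟨ cong (S +_) (*-assoc q (G k 2) X) ⟨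
      S + q * G k 2 * X ∎
    where open ≤-Reasoning

  -- q^r (q^2 - 1) q [k over 2] [n-3 over k-3] < [k] [n-2 over k-2].  Multiplied by [2] [k-2]
  -- and rewritten by absorption, this is  q^(r+1) (q-1) [k-1] [k-2] < [n-2].
  second-bound : q ^ r * (q ^ 2 ∸ 1) * (q * G k 2 * X) < [ k ] * G ((2 + K) + b) (1 + K)
  second-bound = *-cancelˡ-< ([ 2 ] * [ 1 + K ]) _ _ (begin-strict
      [ 2 ] * [ 1 + K ] * (q ^ r * (q ^ 2 ∸ 1) * (q * G k 2 * X))
    ≡⟨ cong (λ d → [ 2 ] * [ 1 + K ] * (q ^ r * d * (q * G k 2 * X))) (q-integer′ 2) ⟨
      [ 2 ] * [ 1 + K ] * (q ^ r * ((1 + w) * [ 2 ]) * (q * G k 2 * X))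
    ≡⟨ regroup₁ [ 2 ] [ 1 + K ] (q ^ r) (1 + w) q (G k 2) X ⟩
      q * q ^ r * (1 + w) * [ 1 + K ] * [ 2 ] * ([ 2 ] * G k 2) * X
    ≡⟨ cong (λ z → q * q ^ r * (1 + w) * [ 1 + K ] * [ 2 ] * z * X) (absorption (2 + K) 1) ⟩
      q * q ^ r * (1 + w) * [ 1 + K ] * [ 2 ] * ([ k ] * [ 2 + K ]) * X
    ≡⟨ regroup₂ (q * q ^ r) (1 + w) [ 1 + K ] [ 2 ] [ k ] [ 2 + K ] X ⟩
      q ^ suc r * (1 + w) * [ 2 + K ] * [ 1 + K ] * M
    <⟨ *-monoˡ-< M {{>-nonZero M≥1}} (q-integer-product< (suc r) (2 + K) (1 + K) (s≤s z≤n)) ⟩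
      [ suc r + (2 + K) + (1 + K) ] * M
    ≡⟨ cong (λ n → [ n ] * M) (size K r) ⟩
      [ (2 + K) + b ] * M
    ≡⟨ regroup₃ [ 2 ] [ k ] [ (2 + K) + b ] X ⟩
      [ 2 ] * [ k ] * ([ (2 + K) + b ] * X)
    ≡⟨ cong ([ 2 ] * [ k ] *_) (absorption ((1 + K) + b) K) ⟨
      [ 2 ] * [ k ] * ([ 1 + K ] * G ((2 + K) + b) (1 + K))
    ≡⟨ regroup₄ [ 2 ] [ k ] [ 1 + K ] (G ((2 + K) + b) (1 + K)) ⟩
      [ 2 ] * [ 1 + K ] * ([ k ] * G ((2 + K) + b) (1 + K)) ∎)
    where
      open ≤-Reasoning
      M : ℕ
      M = [ 2 ] * [ k ] * X
      M≥1 : 1 ≤ M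
      M≥1 = *-mono-≤ (*-mono-≤ {1} {[ 2 ]} (G-pos 2 1 (s≤s z≤n)) (G-pos k 1 (s≤s z≤n)))
                     (G-pos ((1 + K) + b) K (≤-trans (n≤1+n K) (m≤m+n (1 + K) b)))
      size : ∀ K r → suc r + (2 + K) + (1 + K) ≡ (2 + K) + (2 + (K + r))
      size = solve-∀
      regroup₁ : ∀ t s y u q g x → t * s * (y * (u * t) * (q * g * x)) ≡ q * y * u * s * t * (t * g) * x
      regroup₁ = solve-∀
      regroup₂ : ∀ y u s t a m x → y * u * s * t * (a * m) * x ≡ y * u * m * s * (t * a * x)
      regroup₂ = solve-∀
      regroup₃ : ∀ t a n x → n * (t * a * x) ≡ t * a * (n * x)
      regroup₃ = solve-∀
      regroup₄ : ∀ t a s g → t * a * (s * g) ≡ t * s * (a * g)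
      regroup₄ = solve-∀

module IntegerFacts where

  import Data.Nat as ℕ
  import Data.Nat.Properties as ℕ
  open import Data.Integer
  open import Data.Integer.Properties
  open import Relation.Binary.PropositionalEquality
  open import Data.Integer.Tactic.RingSolver using (solve-∀)

  +[m+n]-+m : ∀ m n → + (m ℕ.+ n) - + m ≡ + n
  +[m+n]-+m m n = trans (cong (_- + m) (pos-+ m n)) (cancel (+ m) (+ n))
    where
      cancel : ∀ x y → x + y - x ≡ y
      cancel = solve-∀

  difference<shifted : ∀ {P t s c e x} → P ≡ t ℕ.+ s → c ℕ.≤ s ℕ.+ e → 0 ℕ.< x →
                       + c - + e < (+ P - + t) + + x
  difference<shifted {t = t} {s} {c} {e} {x} refl c≤s+e x>0 = begin-strict
      + c - + e                  ≤⟨ +-monoˡ-≤ (- + e) (+≤+ (ℕ.≤-trans c≤s+e (ℕ.≤-reflexive (ℕ.+-comm s e)))) ⟩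
      + (e ℕ.+ s) - + e          ≡⟨ +[m+n]-+m e s ⟩
      + s                        <⟨ +<+ (ℕ.m<m+n s x>0) ⟩
      + (s ℕ.+ x)                ≡⟨ pos-+ s x ⟩
      + s + + x                  ≡⟨ cong (_+ + x) (+[m+n]-+m t s) ⟨
      (+ (t ℕ.+ s) - + t) + + x  ∎
    where open ≤-Reasoning

  scaled-difference : ∀ {d c e} → d ℕ.* e ℕ.< c → (+ d - + 1) * + c < + d * (+ c - + e)
  scaled-difference {d} {c} {e} de<c = begin-strict
      (+ d - + 1) * + c                              ≡⟨ +-identityʳ ((+ d - + 1) * + c) ⟨
      (+ d - + 1) * + c + 0ℤ                         <⟨ +-monoʳ-< ((+ d - + 1) * + c) c-de>0 ⟩
      (+ d - + 1) * + c + (+ c - + (d ℕ.* e))        ≡⟨ cong (λ z → (+ d - + 1) * + c + (+ c - z)) (pos-* d e) ⟩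
      (+ d - + 1) * + c + (+ c - + d * + e)          ≡⟨ expand (+ d) (+ c) (+ e) ⟩
      + d * (+ c - + e)                              ∎
    where
      open ≤-Reasoning
      c-de>0 : 0ℤ < + c - + (d ℕ.* e)
      c-de>0 = begin-strict
          0ℤ                 <⟨ +<+ (ℕ.m<n⇒0<n∸m de<c) ⟩
          + (c ℕ.∸ d ℕ.* e)  ≡⟨ ⊖-≥ (ℕ.<⇒≤ de<c) ⟨
          c ⊖ d ℕ.* e        ≡⟨ m-n≡m⊖n c (d ℕ.* e) ⟨
          + c - + (d ℕ.* e)  ∎
      expand : ∀ D C E → (D - 1ℤ) * C + (C - D * E) ≡ D * (C - E)
      expand = solve-∀

open import Data.Nat using (_≤_; _∸_; _^_; s≤s; z≤n; nonTrivial⇒n>1)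
open import Data.Nat as ℕ using ()
open import Data.Nat.Properties using (≤-trans; ≤-reflexive; *-identityʳ; ^-monoʳ-≤; m+n∸m≡n)
open import Data.Nat.Primality using (prime⇒nonTrivial; prime⇒nonZero)
open import Data.Nat.Tactic.RingSolver using (solve-∀)
open import Data.Integer using (ℤ; +_; _-_; _<_)
open import Data.Integer as ℤ using ()
open import Data.Product using (_×_; _,_)
open import Relation.Nullary using (¬_)
open import Relation.Binary.PropositionalEquality using (_≡_; refl; sym; trans; cong)

prime-power≥2 : ∀ {q} → IsPrimePower q → 2 ≤ q
prime-power≥2 (p , e , p-prime , e≥1 , refl) =
  ≤-trans (nonTrivial⇒n>1 p {{prime⇒nonTrivial p-prime}})
          (≤-trans (≤-reflexive (sym (*-identityʳ p))) (^-monoʳ-≤ p {{prime⇒nonZero p-prime}} e≥1))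

-- The conclusion of the theorem, with the six Gaussian coefficients
-- [n-1 over k-1], [n-k-1 over k-1], [k over 1], [n-2 over k-2], [k over 2], [n-3 over k-3] abstracted.
Conclusion : (q k r P P′ A A′ E E′ : ℕ) → Set
Conclusion q k r P P′ A A′ E E′ =
  let f = (+ P - + (q ^ (k ℕ.* (k ∸ 1)) ℕ.* P′)) ℤ.+ + (q ^ k)
      C = + (A ℕ.* A′)
      B = C - + (q ℕ.* E ℕ.* E′)
      D = + (q ^ r ℕ.* (q ^ 2 ∸ 1))
  in (B < f) × ((D - + 1) ℤ.* C < D ℤ.* B)

Conclusion-cong : ∀ q k r {P P′ A A′ E E′ Q Q′ B B′ F F′} →
  P ≡ Q → P′ ≡ Q′ → A ≡ B → A′ ≡ B′ → E ≡ F → E′ ≡ F′ →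
  Conclusion q k r Q Q′ B B′ F F′ → Conclusion q k r P P′ A A′ E E′
Conclusion-cong q k r refl refl refl refl refl refl holds = holds

module _ (w K r : ℕ) where

  open import Data.Nat using (_+_; _*_; suc)
  open QBinomialLarge w
  open Bounds w K r
  open IntegerFacts

  conclusion-pascal : Conclusion q k r (G (k + b) (2 + K)) (G b (2 + K)) [ k ] (G ((2 + K) + b) (1 + K)) (G k 2) X
  conclusion-pascal =
      difference<shifted {t = q ^ (k * (2 + K)) * G b (2 + K)} {s = S}
                         {c = [ k ] * G ((2 + K) + b) (1 + K)} {e = q * G k 2 * X}
                         leading-term first-bound (q^n≥1 k)
    , scaled-difference {d = q ^ r * (q ^ 2 ∸ 1)} second-bound

  conclusion-gauss : let n = 2 * k + r in
    Conclusion q k r (gauss q (n ∸ 1) (k ∸ 1)) (gauss q (n ∸ k ∸ 1) (k ∸ 1)) (gauss q k 1)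
                     (gauss q (n ∸ 2) (k ∸ 2)) (gauss q k 2) (gauss q (n ∸ 3) (k ∸ 3))
  conclusion-gauss =
    Conclusion-cong q k r (coefficient (2 + K) (cong (_∸ 1) n≡4+K+b)) (coefficient (2 + K) n-k-1≡b)
                          (gauss≡G k 1) (coefficient (1 + K) (cong (_∸ 2) n≡4+K+b))
                          (gauss≡G k 2) (coefficient K (cong (_∸ 3) n≡4+K+b))
                          conclusion-pascal
    where
      coefficient : ∀ j {m m′} → m ≡ m′ → gauss q m j ≡ G m′ j
      coefficient j {m} refl = gauss≡G m j
      shape₁ : ∀ K r → 2 * (3 + K) + r ≡ 4 + (K + (2 + (K + r)))
      shape₁ = solve-∀
      shape₂ : ∀ K r → 2 * (3 + K) + r ≡ (3 + K) + suc (2 + (K + r))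
      shape₂ = solve-∀
      n≡4+K+b : 2 * k + r ≡ 4 + (K + b)
      n≡4+K+b = shape₁ K r
      n-k-1≡b : 2 * k + r ∸ k ∸ 1 ≡ b
      n-k-1≡b = cong (_∸ 1) (trans (cong (_∸ k) (shape₂ K r)) (m+n∸m≡n k (suc b)))

-- Lemma 2.8.
lemma2p8 : (q k r : ℕ) → IsPrimePower q → 3 ≤ k → 4 ≤ r → ¬ ((r ≡ 4) × (q ≡ 2)) →
    let n = 2 ℕ.* k ℕ.+ r
        f = (+ gauss q (n ∸ 1) (k ∸ 1) - + (q ^ (k ℕ.* (k ∸ 1)) ℕ.* gauss q (n ∸ k ∸ 1) (k ∸ 1))) ℤ.+ + (q ^ k)
        C = + (gauss q k 1 ℕ.* gauss q (n ∸ 2) (k ∸ 2))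
        B = C - + (q ℕ.* gauss q k 2 ℕ.* gauss q (n ∸ 3) (k ∸ 3))
        D = + (q ^ r ℕ.* (q ^ 2 ∸ 1))
    in (B < f) × ((D - + 1) ℤ.* C < D ℤ.* B)
lemma2p8 q k r q-prime-power 3≤k _ _ with prime-power≥2 q-prime-power | 3≤k
... | s≤s (s≤s (z≤n {w})) | s≤s (s≤s (s≤s (z≤n {K}))) = conclusion-gauss w K r
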